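{- Let $\mathcal F$ be a group pair with $A$ as in the context, and let $(x,y),(y,z)\in\mathcal E$, so that also $(x,z)\in\mathcal E$. Put $M=\varphi_{xy}^{ -1}[K_{xy}\circ H_{yz}]$; this is a normal subgroup of $G_x$. The following are equivalent: (i) the relation $R_{xy,0}\,;\,R_{yz,0}$ is in $A$; (ii) for each $\alpha<\kappa_{xy}$ and each $\beta<\kappa_{yz}$, the relation $R_{xy,\alpha}\,;\,R_{yz,\beta}$ is in $A$; (iii) for each $\alpha<\kappa_{xy}$ and each $\beta<\kappa_{yz}$, $$R_{xy,\alpha}\,;\,R_{yz,\beta}=\bigcup\{R_{xz,\gamma}:\gamma<\kappa_{xz},\ H_{xz,\gamma}\subseteq\varphi_{xy}^{ -1}[K_{xy,\alpha}\circ H_{yz,\beta}]\};$$ (iv) $H_{xz}\subseteq M$, and $\hat\varphi_{xy}\,;\,\hat\varphi_{yz}=\hat\varphi_{xz}$. Here $\hat\varphi_{xy}$ and $\hat\varphi_{xz}$ are the mappings induced by $\varphi_{xy}$ and $\varphi_{xz}$ on $G_x/M$, and $\hat\varphi_{yz}$ is the isomorphism induced by $\varphi_{yz}$ on $G_y/(K_{xy}\circ H_{yz})$. Consequently, $A$ is closed under relational composition if and only if (iv) holds for all pairs $(x,y),(y,z)\in\mathcal E$.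
   Context: A group pair consists of the following data. - Pairwise disjoint groups $G_x$ ($x\in I$), with operation $\circ$ and identity $e_x$. - An equivalence relation $\mathcal E$ on $I$. - For each $(x,y)\in\mathcal E$, an isomorphism $\varphi_{xy}:G_x/H_{xy}\to G_y/K_{xy}$, where $H_{xy}\trianglelefteq G_x$ and $K_{xy}\trianglelefteq G_y$. Write $X\circ Y=\{a\circ b:a\in X,b\in Y\}$. For each $(x,y)\in\mathcal E$ fix an enumeration without repetitions $\langle H_{xy,\gamma}:\gamma<\kappa_{xy}\rangle$ of the cosets of $H_{xy}$, with $H_{xy,0}=H_{xy}$, and put $K_{xy,\gamma}=\varphi_{xy}(H_{xy,\gamma})$. Define $R_{xy,\alpha}=\bigcup_{\gamma<\kappa_{xy}}H_{xy,\gamma}\times(K_{xy,\gamma}\circ K_{xy,\alpha})$. Let $A$ be the set of all unions of subfamilies of the relations $R_{xy,\alpha}$. $R\,;\,S$ denotes relational composition. Images of unions of cosets: - For $S\subseteq G_x$ a union of cosets of $H_{xy}$, $\varphi_{xy}[S]$ is the union of $\varphi_{xy}(H)$ over the cosets $H\subseteq S$. - For $T\subseteq G_y$ a union of cosets of $K_{xy}$, $\varphi_{xy}^{ -1}[T]$ is the union of the cosets $H$ of $H_{xy}$ with $\varphi_{xy}(H)\subseteq T$. Induced maps: if $N$ is a normal subgroup of $G_x$ that is a union of cosets of $H_{xy}$, the map induced by $\varphi_{xy}$ on $G_x/N$ sends each coset $C$ of $N$ to $\varphi_{xy}[C]$; similarly for the other isomorphisms. For maps $f,g$, $f\,;\,g$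 means first $f$ then $g$. -}

module Defs where

open import Level using (0ℓ)
open import Data.Product using (Σ; ∃; ∃-syntax; _×_; _,_)
open import Relation.Binary.PropositionalEquality using (_≡_; trans)
open import Relation.Binary.Structures using (IsEquivalence)
open import Relation.Unary using (Pred; _∈_; _⊆_; _≐_)
open import Algebra.Structures using (IsGroup)
open import Function.Bundles using (_⇔_)

record GroupOn (C : Set) : Set where
  infixl 7 _∙_
  field
    _∙_     : C → C → C
    ε       : C
    _⁻¹     : C → C
    isGroup : IsGroup _≡_ _∙_ ε _⁻¹

module _ {C : Set} (G : GroupOn C) where
  open GroupOn G

  prod : Pred C 0ℓ → Pred C 0ℓ → Pred C 0ℓ
  prod X Y c = ∃[ a ] ∃[ b ] (a ∈ X × b ∈ Y × c ≡ a ∙ b)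

  coset : C → Pred C 0ℓ → Pred C 0ℓ
  coset a N c = ∃[ n ] (n ∈ N × c ≡ a ∙ n)

  record IsNormalSubgroup (N : Pred C 0ℓ) : Set where
    field
      ε∈N   : ε ∈ N
      ∙-closed : ∀ {a b} → a ∈ N → b ∈ N → (a ∙ b) ∈ N
      ⁻¹-closed : ∀ {a} → a ∈ N → (a ⁻¹) ∈ N
      conj-closed : ∀ g {n} → n ∈ N → ((g ∙ n) ∙ (g ⁻¹)) ∈ N

-- An isomorphism φ : G₁/H → G₂/K, together with a fixed enumeration
-- (without repetitions, starting with H itself) of the cosets of H.
--
-- Quotients are not types in Agda; the isomorphism is given by a map f on
-- representatives:  φ (a ∘ H) = f a ∘ K.
-- The enumeration ⟨ H_γ : γ < κ ⟩ is given by an index type Idx (playing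
-- the role of κ) and representatives: H_γ = rep γ ∘ H.

record QIso {A B : Set} (G₁ : GroupOn A) (G₂ : GroupOn B) : Set₁ where
  open GroupOn G₁ renaming (_∙_ to _∙₁_)
  open GroupOn G₂ renaming (_∙_ to _∙₂_)
  field
    H        : Pred A 0ℓ
    H-normal : IsNormalSubgroup G₁ H
    K        : Pred B 0ℓ
    K-normal : IsNormalSubgroup G₂ K
    f        : A → B
    f-wd     : ∀ a a′ → a′ ∈ coset G₁ a H → f a′ ∈ coset G₂ (f a) K
    f-inj    : ∀ a a′ → f a′ ∈ coset G₂ (f a) K → a′ ∈ coset G₁ a H
    f-hom    : ∀ a a′ → f (a ∙₁ a′) ∈ coset G₂ (f a ∙₂ f a′) K
    f-surj   : ∀ b → ∃[ a ] (b ∈ coset G₂ (f a) K)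
    Idx      : Set
    rep      : Idx → A
    0ᵢ       : Idx
    rep-0    : coset G₁ (rep 0ᵢ) H ≐ H
    rep-cover    : ∀ a → ∃[ γ ] (a ∈ coset G₁ (rep γ) H)
    rep-distinct : ∀ γ δ → coset G₁ (rep γ) H ≐ coset G₁ (rep δ) H → γ ≡ δ

  φ-coset : A → Pred B 0ℓ
  φ-coset a = coset G₂ (f a) K

  Hγ : Idx → Pred A 0ℓ
  Hγ γ = coset G₁ (rep γ) H

  Kγ : Idx → Pred B 0ℓ
  Kγ γ = φ-coset (rep γ)

  image : Pred A 0ℓ → Pred B 0ℓ
  image S b = ∃[ a ] (coset G₁ a H ⊆ S × b ∈ φ-coset a)

  preimage : Pred B 0ℓ → Pred A 0ℓ
  preimage T a = ∃[ a₀ ] (a ∈ coset G₁ a₀ H × φ-coset a₀ ⊆ T)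

  -- the map induced by φ on a quotient G₁/N (N a union of cosets of H):
  -- a coset C of N is sent to φ[C]
  induced : Pred A 0ℓ → Pred B 0ℓ
  induced C = image C

record GroupPair : Set₁ where
  field
    I       : Set
    C       : I → Set          -- G_x (disjointness: disjoint union Σ I C)
    G       : (x : I) → GroupOn (C x)
    E       : I → I → Set
    E-equiv : IsEquivalence E
    E-prop  : ∀ {x y} (p q : E x y) → p ≡ q   -- ℰ is a relation (a set of pairs)
    φ       : ∀ {x y} → E x y → QIso (G x) (G y)

module GroupPairTheory (𝓕 : GroupPair) where
  open GroupPair 𝓕

  BRel : Set₁
  BRel = (i j : I) → C i → C j → Set

  _⊆ᴿ_ : BRel → BRel → Set
  R ⊆ᴿ S = ∀ i j a b → R i j a b → S i j a b

  _≐ᴿ_ : BRel → BRel → Set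
  R ≐ᴿ S = (R ⊆ᴿ S) × (S ⊆ᴿ R)

  _⨾_ : BRel → BRel → BRel
  (R ⨾ S) i k a c = ∃[ j ] ∃[ b ] (R i j a b × S j k b c)

  data On {x y : I} (P : C x → C y → Set) : (i j : I) → C i → C j → Set where
    on : ∀ {a b} → P a b → On P x y a b

  Rel : ∀ {x y} (e : E x y) → QIso.Idx (φ e) → BRel
  Rel {x} {y} e α = On {x} {y} (λ a b →
    ∃[ γ ] (a ∈ QIso.Hγ (φ e) γ × b ∈ prod (G y) (QIso.Kγ (φ e) γ) (QIso.Kγ (φ e) α)))

  Index : Set
  Index = Σ I λ x → Σ I λ y → Σ (E x y) λ e → QIso.Idx (φ e)

  Rel′ : Index → BRel
  Rel′ (x , y , e , α) = Rel e α

  ⋃ᴿ : Pred Index 0ℓ → BRel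
  ⋃ᴿ S i j a b = ∃[ ι ] (ι ∈ S × Rel′ ι i j a b)

  InA : BRel → Set₁
  InA R = ∃[ S ] (R ≐ᴿ ⋃ᴿ S)

  ClosedUnderComposition : Set₁
  ClosedUnderComposition = ∀ R S → InA R → InA S → InA (R ⨾ S)

  module _ {x y z : I} (e₁ : E x y) (e₂ : E y z) where
    open IsEquivalence E-equiv using () renaming (trans to E-trans)

    e₃ : E x z
    e₃ = E-trans e₁ e₂

    private
      module P = QIso (φ e₁)
      module Q = QIso (φ e₂)
      module R = QIso (φ e₃)

    M : Pred (C x) 0ℓ
    M = P.preimage (prod (G y) P.K Q.H)

    cond-i : Set₁
    cond-i = InA (Rel e₁ P.0ᵢ ⨾ Rel e₂ Q.0ᵢ)

    cond-ii : Set₁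
    cond-ii = ∀ α β → InA (Rel e₁ α ⨾ Rel e₂ β)

    cond-iii : Set
    cond-iii = ∀ α β →
      (Rel e₁ α ⨾ Rel e₂ β) ≐ᴿ
      (λ i k a c → ∃[ γ ] (R.Hγ γ ⊆ P.preimage (prod (G y) (P.Kγ α) (Q.Hγ β))
                           × Rel e₃ γ i k a c))

    -- φ̂_xy ; φ̂_yz = φ̂_xz  as maps on G_x/M (checked on every coset a ∘ M)
    cond-iv : Set
    cond-iv = (R.H ⊆ M)
            × (∀ a → Q.induced (P.induced (coset (G x) a M))
                     ≐ R.induced (coset (G x) a M))

module Submission where

-- Fix (x, y), (y, z) ∈ ℰ and write P = φ_xy, Q = φ_yz, R = φ_xz with
-- representative maps f, g, h.  Put KH = K_xy ∘ H_yz, L = φ_yz[KH] and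
-- M = φ_xy⁻¹[KH]; then g ∘ f is an isomorphism G_x/M ≅ G_z/L.  The heart of
-- the proof is the notion of a coherent triangle: H_xz ⊆ M, K_xz ⊆ L and
-- h ≈ g ∘ f modulo L.  We show
--   (iv) ⇔ coherent,   coherent ⇒ (iii) ⇒ (ii) ⇒ (i) ⇒ coherent,
-- where (iii) and (i) are first read inside G_x × G_z, on which the relations
-- R_{xy,α} ; R_{yz,β} and R_{xz,γ} live.

open import Level using (0ℓ)
open import Function.Base using (_∘_)
open import Data.Product using (Σ; ∃-syntax; _×_; _,_; proj₁; proj₂)
open import Relation.Binary.PropositionalEquality using (_≡_; refl; sym; trans; cong; subst)
open import Relation.Binary.Bundles using (Setoid)
import Relation.Binary.Reasoning.Setoid as SetoidReasoning
open import Relation.Unary using (Pred; _∈_; _⊆_; _≐_)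
open import Function.Bundles using (_⇔_; mk⇔; Equivalence)
open import Algebra.Bundles using (Group)
open import Algebra.Structures using (IsGroup)
import Algebra.Properties.Group as GroupProperties
open import Defs

open Equivalence using (to; from)

module GroupFacts {C : Set} (G : GroupOn C) where
  open GroupOn G public
  open IsGroup isGroup public using (assoc; identityˡ; identityʳ; inverseˡ; inverseʳ)

  group : Group 0ℓ 0ℓ
  group = record { isGroup = isGroup }

  open GroupProperties group public
    using (ε⁻¹≈ε; ⁻¹-involutive; ⁻¹-anti-homo-∙;
           \\-leftDividesˡ; \\-leftDividesʳ; //-rightDividesˡ; //-rightDividesʳ)

  inverse-of-product : ∀ a b c → (a ∙ b) ⁻¹ ∙ c ≡ b ⁻¹ ∙ (a ⁻¹ ∙ c)
  inverse-of-product a b c = trans (cong (_∙ c) (⁻¹-anti-homo-∙ a b)) (assoc _ _ _)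

-- Congruence modulo a normal subgroup N:  a ≈ b  iff  a⁻¹ b ∈ N  iff  a N = b N.
-- Since quotients are not types, every statement about G/N is phrased with ≈.
module Congruence {C : Set} (G : GroupOn C) (N : Pred C 0ℓ) (N-normal : IsNormalSubgroup G N) where
  open GroupFacts G
  open IsNormalSubgroup N-normal

  infix 4 _≈_
  _≈_ : C → C → Set
  a ≈ b = a ⁻¹ ∙ b ∈ N

  ∈-resp-≡ : ∀ {a b} → a ≡ b → a ∈ N → b ∈ N
  ∈-resp-≡ = subst (_∈ N)

  ≈-resp-≡ : ∀ {a a′ b b′} → a ≡ a′ → b ≡ b′ → a ≈ b → a′ ≈ b′
  ≈-resp-≡ refl refl p = p

  ≈-refl : ∀ {a} → a ≈ a
  ≈-refl {a} = ∈-resp-≡ (sym (inverseˡ a)) ε∈N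

  ≡⇒≈ : ∀ {a b} → a ≡ b → a ≈ b
  ≡⇒≈ refl = ≈-refl

  ≈-sym : ∀ {a b} → a ≈ b → b ≈ a
  ≈-sym {a} {b} p =
    ∈-resp-≡ (trans (⁻¹-anti-homo-∙ (a ⁻¹) b) (cong (b ⁻¹ ∙_) (⁻¹-involutive a))) (⁻¹-closed p)

  ≈-trans : ∀ {a b c} → a ≈ b → b ≈ c → a ≈ c
  ≈-trans {a} {b} {c} p q =
    ∈-resp-≡ (trans (assoc _ _ _) (cong (a ⁻¹ ∙_) (\\-leftDividesˡ b c))) (∙-closed p q)

  setoid : Setoid 0ℓ 0ℓ
  setoid = record
    { _≈_ = _≈_ ; isEquivalence = record { refl = ≈-refl ; sym = ≈-sym ; trans = ≈-trans } }

  module ≈-Reasoning = SetoidReasoning setoid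

  ∙-congˡ : ∀ {a b} c → a ≈ b → c ∙ a ≈ c ∙ b
  ∙-congˡ {a} {b} c p =
    ∈-resp-≡ (sym (trans (inverse-of-product c a (c ∙ b)) (cong (a ⁻¹ ∙_) (\\-leftDividesʳ c b)))) p

  -- right multiplication is where normality is needed: (ac)⁻¹(bc) = c⁻¹ (a⁻¹b) c
  ∙-congʳ : ∀ {a b} c → a ≈ b → a ∙ c ≈ b ∙ c
  ∙-congʳ {a} {b} c p = ∈-resp-≡ conjugate (conj-closed (c ⁻¹) p)
    where
    conjugate : (c ⁻¹ ∙ (a ⁻¹ ∙ b)) ∙ c ⁻¹ ⁻¹ ≡ (a ∙ c) ⁻¹ ∙ (b ∙ c)
    conjugate = trans (cong ((c ⁻¹ ∙ (a ⁻¹ ∙ b)) ∙_) (⁻¹-involutive c))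
               (trans (assoc _ _ _)
               (trans (cong (c ⁻¹ ∙_) (assoc _ _ _))
                      (sym (inverse-of-product a c (b ∙ c)))))

  ∙-cong : ∀ {a b c d} → a ≈ b → c ≈ d → a ∙ c ≈ b ∙ d
  ∙-cong {b = b} {c = c} p q = ≈-trans (∙-congʳ c p) (∙-congˡ b q)

  -- inversion respects ≈ (again by normality): (a⁻¹)⁻¹ b⁻¹ = a (a⁻¹b)⁻¹ a⁻¹
  ⁻¹-cong : ∀ {a b} → a ≈ b → a ⁻¹ ≈ b ⁻¹
  ⁻¹-cong {a} {b} p = ∈-resp-≡ conjugate (conj-closed a (⁻¹-closed p))
    where
    conjugate : (a ∙ (a ⁻¹ ∙ b) ⁻¹) ∙ a ⁻¹ ≡ a ⁻¹ ⁻¹ ∙ b ⁻¹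
    conjugate =
      trans (cong (λ t → (a ∙ t) ∙ a ⁻¹)
                  (trans (⁻¹-anti-homo-∙ (a ⁻¹) b) (cong (b ⁻¹ ∙_) (⁻¹-involutive a))))
     (trans (cong (_∙ a ⁻¹) (sym (assoc a (b ⁻¹) a)))
     (trans (//-rightDividesʳ a (a ∙ b ⁻¹))
            (cong (_∙ b ⁻¹) (sym (⁻¹-involutive a)))))

  ∙-cancelˡ : ∀ x {y y′} → x ∙ y ≈ x ∙ y′ → y ≈ y′
  ∙-cancelˡ x {y} {y′} p =
    ∈-resp-≡ (trans (inverse-of-product x y (x ∙ y′)) (cong (y ⁻¹ ∙_) (\\-leftDividesʳ x y′))) p

  ∙-cancelʳ : ∀ x {y y′} → y ∙ x ≈ y′ ∙ x → y ≈ y′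
  ∙-cancelʳ x {y} {y′} p = ≈-resp-≡ (//-rightDividesʳ x y) (//-rightDividesʳ x y′) (∙-congʳ (x ⁻¹) p)

  ∈⇒ε≈ : ∀ {n} → n ∈ N → ε ≈ n
  ∈⇒ε≈ {n} = ∈-resp-≡ (sym (trans (cong (_∙ n) ε⁻¹≈ε) (identityˡ n)))

  ε≈⇒∈ : ∀ {n} → ε ≈ n → n ∈ N
  ε≈⇒∈ {n} = ∈-resp-≡ (trans (cong (_∙ n) ε⁻¹≈ε) (identityˡ n))

  ∈-resp-≈ : ∀ {n m} → n ∈ N → n ≈ m → m ∈ N
  ∈-resp-≈ p q = ε≈⇒∈ (≈-trans (∈⇒ε≈ p) q)

  ∈⇒≈ : ∀ {n m} → n ∈ N → m ∈ N → n ≈ m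
  ∈⇒≈ p q = ≈-trans (≈-sym (∈⇒ε≈ p)) (∈⇒ε≈ q)

  ∈⇒≈∙ : ∀ y {x} → x ∈ N → y ≈ y ∙ x
  ∈⇒≈∙ y {x} = ∈-resp-≡ (sym (\\-leftDividesʳ y x))

  ≈∙⇒∈ : ∀ y {x} → y ≈ y ∙ x → x ∈ N
  ≈∙⇒∈ y {x} = ∈-resp-≡ (\\-leftDividesʳ y x)

  coset⇒≈ : ∀ {a b} → coset G a N b → a ≈ b
  coset⇒≈ {a} (n , n∈N , refl) = ∈⇒≈∙ a n∈N

  ≈⇒coset : ∀ {a b} → a ≈ b → coset G a N b
  ≈⇒coset {a} {b} p = a ⁻¹ ∙ b , p , sym (\\-leftDividesˡ a b)

module ProductSubgroup {C : Set} (G : GroupOn C) {N₁ N₂ : Pred C 0ℓ}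
                       (N₁-normal : IsNormalSubgroup G N₁) (N₂-normal : IsNormalSubgroup G N₂) where
  open GroupFacts G
  private
    module Cong₁ = Congruence G N₁ N₁-normal
    module Cong₂ = Congruence G N₂ N₂-normal
    module Sub₁ = IsNormalSubgroup N₁-normal
    module Sub₂ = IsNormalSubgroup N₂-normal
  open Cong₁ using () renaming (_≈_ to _≈₁_)
  open Cong₂ using () renaming (_≈_ to _≈₂_)

  N₁N₂ : Pred C 0ℓ
  N₁N₂ = prod G N₁ N₂

  ∈N₁N₂⇒ : ∀ {c} → c ∈ N₁N₂ → ∃[ k ] (k ∈ N₁ × k ≈₂ c)
  ∈N₁N₂⇒ (k , n , k∈N₁ , n∈N₂ , refl) = k , k∈N₁ , Cong₂.∈⇒≈∙ k n∈N₂

  ⇒∈N₁N₂ : ∀ {k c} → k ∈ N₁ → k ≈₂ c → c ∈ N₁N₂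
  ⇒∈N₁N₂ {k} {c} k∈N₁ p = k , k ⁻¹ ∙ c , k∈N₁ , p , sym (\\-leftDividesˡ k c)

  normal : IsNormalSubgroup G N₁N₂
  normal = record
    { ε∈N = ⇒∈N₁N₂ Sub₁.ε∈N Cong₂.≈-refl
    ; ∙-closed = λ p q →
        let (k , k∈N₁ , r) = ∈N₁N₂⇒ p ; (k′ , k′∈N₁ , r′) = ∈N₁N₂⇒ q
        in ⇒∈N₁N₂ (Sub₁.∙-closed k∈N₁ k′∈N₁) (Cong₂.∙-cong r r′)
    ; ⁻¹-closed = λ p → let (k , k∈N₁ , r) = ∈N₁N₂⇒ p in ⇒∈N₁N₂ (Sub₁.⁻¹-closed k∈N₁) (Cong₂.⁻¹-cong r)
    ; conj-closed = λ g p → let (k , k∈N₁ , r) = ∈N₁N₂⇒ p in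
        ⇒∈N₁N₂ (Sub₁.conj-closed g k∈N₁) (Cong₂.∙-congʳ (g ⁻¹) (Cong₂.∙-congˡ g r))
    }

  module Cong = Congruence G N₁N₂ normal
  open Cong using (_≈_)

  N₁⊆N₁N₂ : N₁ ⊆ N₁N₂
  N₁⊆N₁N₂ {c} p = c , ε , p , Sub₂.ε∈N , sym (identityʳ c)

  N₂⊆N₁N₂ : N₂ ⊆ N₁N₂
  N₂⊆N₁N₂ {c} p = ε , c , Sub₁.ε∈N , p , sym (identityˡ c)

  factor : ∀ {a d} → a ≈ d → ∃[ b ] (a ≈₁ b × b ≈₂ d)
  factor {a} {d} p with ∈N₁N₂⇒ p
  ... | k , k∈N₁ , q = a ∙ k , Cong₁.∈⇒≈∙ a k∈N₁ , Cong₂.∈-resp-≡ (sym (inverse-of-product a k d)) q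

  coset-product : ∀ x y {d} → prod G (coset G x N₁) (coset G y N₂) d ⇔ x ∙ y ≈ d
  coset-product x y = mk⇔ product⇒ ⇒product
    where
    product⇒ : ∀ {d} → prod G (coset G x N₁) (coset G y N₂) d → x ∙ y ≈ d
    product⇒ (u , w , p , q , refl) = Cong.∙-cong (N₁⊆N₁N₂ (Cong₁.coset⇒≈ p)) (N₂⊆N₁N₂ (Cong₂.coset⇒≈ q))

    -- write d = x y k n with k ∈ N₁, n ∈ N₂; then d = (x (y k y⁻¹)) (y n)
    ⇒product : ∀ {d} → x ∙ y ≈ d → prod G (coset G x N₁) (coset G y N₂) d
    ⇒product {d} p with ∈N₁N₂⇒ p
    ... | k , k∈N₁ , q =
      u , w , Cong₁.≈⇒coset (Cong₁.∈⇒≈∙ x (Sub₁.conj-closed y k∈N₁)) ,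
              Cong₂.≈⇒coset (Cong₂.∈⇒≈∙ y q) , sym u∙w≡d
      where
      t u w : C
      t = (x ∙ y) ⁻¹ ∙ d
      u = x ∙ ((y ∙ k) ∙ y ⁻¹)
      w = y ∙ (k ⁻¹ ∙ t)
      u∙w≡d : u ∙ w ≡ d
      u∙w≡d = trans (assoc x _ _)
             (trans (cong (x ∙_) (trans (assoc _ _ _) (cong ((y ∙ k) ∙_) (\\-leftDividesʳ y (k ⁻¹ ∙ t)))))
             (trans (cong (x ∙_) (trans (assoc y k _) (cong (y ∙_) (\\-leftDividesˡ k t))))
             (trans (sym (assoc x y t)) (\\-leftDividesˡ (x ∙ y) d))))

module QuotientIso {A B : Set} {G₁ : GroupOn A} {G₂ : GroupOn B} (φ : QIso G₁ G₂) where
  open QIso φ public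
  private
    module G₁ = GroupFacts G₁
    module G₂ = GroupFacts G₂
  module SubH = IsNormalSubgroup H-normal
  open G₁ using () renaming (_∙_ to _∙₁_; ε to ε₁; _⁻¹ to _⁻¹₁)
  open G₂ using () renaming (_∙_ to _∙₂_; ε to ε₂; _⁻¹ to _⁻¹₂)

  module CongH = Congruence G₁ H H-normal
  module CongK = Congruence G₂ K K-normal
  open CongH using () renaming (_≈_ to _≈H_)
  open CongK using () renaming (_≈_ to _≈K_)

  f-cong : ∀ {a a′} → a ≈H a′ → f a ≈K f a′
  f-cong {a} {a′} p = CongK.coset⇒≈ (f-wd a a′ (CongH.≈⇒coset p))

  f-reflect : ∀ {a a′} → f a ≈K f a′ → a ≈H a′
  f-reflect {a} {a′} p = CongH.coset⇒≈ (f-inj a a′ (CongK.≈⇒coset p))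

  f-∙ : ∀ a a′ → f (a ∙₁ a′) ≈K f a ∙₂ f a′
  f-∙ a a′ = CongK.≈-sym (CongK.coset⇒≈ (f-hom a a′))

  f-onto : ∀ b → ∃[ a ] (f a ≈K b)
  f-onto b = let (a , p) = f-surj b in a , CongK.coset⇒≈ p

  f-ε : ε₂ ≈K f ε₁
  f-ε = CongK.∙-cancelˡ (f ε₁)
          (CongK.≈-resp-≡ (trans (cong f (G₁.identityˡ ε₁)) (sym (G₂.identityʳ (f ε₁)))) refl
                          (f-∙ ε₁ ε₁))

  f-⁻¹ : ∀ a → f a ⁻¹₂ ≈K f (a ⁻¹₁)
  f-⁻¹ a = CongK.∙-cancelˡ (f a)
             (CongK.≈-resp-≡ (sym (G₂.inverseʳ (f a))) refl
               (CongK.≈-trans f-ε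
                 (CongK.≈-resp-≡ (cong f (G₁.inverseʳ a)) refl (f-∙ a (a ⁻¹₁)))))

  f-\\ : ∀ a b → f a ⁻¹₂ ∙₂ f b ≈K f (a ⁻¹₁ ∙₁ b)
  f-\\ a b = CongK.≈-trans (CongK.∙-congʳ (f b) (f-⁻¹ a)) (CongK.≈-sym (f-∙ (a ⁻¹₁) b))

  f[H]⊆K : ∀ {a} → a ∈ H → f a ∈ K
  f[H]⊆K p = CongK.ε≈⇒∈ (CongK.≈-trans f-ε (f-cong (CongH.∈⇒ε≈ p)))

  image-⊆ : ∀ {S S′} → S ⊆ S′ → image S ⊆ image S′
  image-⊆ S⊆S′ (a , aH⊆S , b∈φaH) = a , S⊆S′ ∘ aH⊆S , b∈φaH

  preimage-⊆ : ∀ {T T′} → T ⊆ T′ → preimage T ⊆ preimage T′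
  preimage-⊆ T⊆T′ (a₀ , a∈a₀H , φa₀H⊆T) = a₀ , a∈a₀H , T⊆T′ ∘ φa₀H⊆T

  module Image (N : Pred A 0ℓ) (N-normal : IsNormalSubgroup G₁ N) where
    private
      module SubN = IsNormalSubgroup N-normal
      module CongN = Congruence G₁ N N-normal
    open CongN using () renaming (_≈_ to _≈N_)

    Img : Pred B 0ℓ
    Img c = ∃[ m ] (m ∈ N × f m ≈K c)

    Img-normal : IsNormalSubgroup G₂ Img
    Img-normal = record
      { ε∈N = ε₁ , SubN.ε∈N , CongK.≈-sym f-ε
      ; ∙-closed = λ { (m , m∈N , p) (m′ , m′∈N , p′) →
          m ∙₁ m′ , SubN.∙-closed m∈N m′∈N , CongK.≈-trans (f-∙ m m′) (CongK.∙-cong p p′) }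
      ; ⁻¹-closed = λ { (m , m∈N , p) →
          m ⁻¹₁ , SubN.⁻¹-closed m∈N , CongK.≈-trans (CongK.≈-sym (f-⁻¹ m)) (CongK.⁻¹-cong p) }
      ; conj-closed = λ { g (m , m∈N , p) → let (w , q) = f-onto g in
          (w ∙₁ m) ∙₁ w ⁻¹₁ , SubN.conj-closed w m∈N ,
          CongK.≈-trans (f-∙ (w ∙₁ m) (w ⁻¹₁))
            (CongK.∙-cong (CongK.≈-trans (f-∙ w m) (CongK.∙-cong q p))
                          (CongK.≈-trans (CongK.≈-sym (f-⁻¹ w)) (CongK.⁻¹-cong q))) }
      }

    module CongImg = Congruence G₂ Img Img-normal
    open CongImg using () renaming (_≈_ to _≈Img_)

    K⊆Img : K ⊆ Img
    K⊆Img k∈K = ε₁ , SubN.ε∈N , CongK.≈-trans (CongK.≈-sym f-ε) (CongK.∈⇒ε≈ k∈K)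

    f∈Img : ∀ {m} → m ∈ N → f m ∈ Img
    f∈Img m∈N = _ , m∈N , CongK.≈-refl

    Img-cong : ∀ {a b} → a ≈N b → f a ≈Img f b
    Img-cong {a} {b} p = a ⁻¹₁ ∙₁ b , p , CongK.≈-sym (f-\\ a b)

    Img-reflect : H ⊆ N → ∀ {a b} → f a ≈Img f b → a ≈N b
    Img-reflect H⊆N {a} {b} (m , m∈N , p) =
      CongN.∈-resp-≈ m∈N (H⊆N (f-reflect (CongK.≈-trans p (f-\\ a b))))

    Img-reflect-∈ : H ⊆ N → ∀ {a} → f a ∈ Img → a ∈ N
    Img-reflect-∈ H⊆N (m , m∈N , p) = CongN.∈-resp-≈ m∈N (H⊆N (f-reflect p))

    image-coset : H ⊆ N → ∀ a {c} → c ∈ image (coset G₁ a N) ⇔ f a ≈Img c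
    image-coset H⊆N a = mk⇔ image⇒ ⇒image
      where
      image⇒ : ∀ {c} → c ∈ image (coset G₁ a N) → f a ≈Img c
      image⇒ (a₀ , a₀H⊆aN , c∈φa₀H) =
        CongImg.≈-trans (Img-cong (CongN.coset⇒≈ (a₀H⊆aN (CongH.≈⇒coset CongH.≈-refl))))
                        (K⊆Img (CongK.coset⇒≈ c∈φa₀H))

      ⇒image : ∀ {c} → f a ≈Img c → c ∈ image (coset G₁ a N)
      ⇒image {c} (m , m∈N , p) =
        a ∙₁ m ,
        (λ {_} q → CongN.≈⇒coset (CongN.≈-trans (CongN.∈⇒≈∙ a m∈N) (H⊆N (CongH.coset⇒≈ q)))) ,
        CongK.≈⇒coset (CongK.≈-trans (f-∙ a m)
                        (CongK.≈-resp-≡ refl (G₂.\\-leftDividesˡ (f a) c) (CongK.∙-congˡ (f a) p)))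

  module Preimage (N′ : Pred B 0ℓ) (N′-normal : IsNormalSubgroup G₂ N′) (K⊆N′ : K ⊆ N′) where
    private
      module SubN′ = IsNormalSubgroup N′-normal
      module CongN′ = Congruence G₂ N′ N′-normal
    open CongN′ using () renaming (_≈_ to _≈N′_)

    preimage-char : ∀ {v} → v ∈ preimage N′ ⇔ f v ∈ N′
    preimage-char {v} = mk⇔
      (λ { (a₀ , v∈a₀H , φa₀H⊆N′) →
             CongN′.∈-resp-≈ (φa₀H⊆N′ (CongK.≈⇒coset CongK.≈-refl))
                             (K⊆N′ (f-cong (CongH.coset⇒≈ v∈a₀H))) })
      (λ fv∈N′ → v , CongH.≈⇒coset CongH.≈-refl ,
                 λ {_} q → CongN′.∈-resp-≈ fv∈N′ (K⊆N′ (CongK.coset⇒≈ q)))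

    preimage-coset : ∀ b {v} → v ∈ preimage (coset G₂ b N′) ⇔ b ≈N′ f v
    preimage-coset b {v} = mk⇔
      (λ { (a₀ , v∈a₀H , φa₀H⊆bN′) →
             CongN′.≈-trans (CongN′.coset⇒≈ (φa₀H⊆bN′ (CongK.≈⇒coset CongK.≈-refl)))
                            (K⊆N′ (f-cong (CongH.coset⇒≈ v∈a₀H))) })
      (λ p → v , CongH.≈⇒coset CongH.≈-refl ,
             λ {_} q → CongN′.≈⇒coset (CongN′.≈-trans p (K⊆N′ (CongK.coset⇒≈ q))))

    H⊆preimage : H ⊆ preimage N′
    H⊆preimage h∈H = from preimage-char (K⊆N′ (f[H]⊆K h∈H))

    preimage-normal : IsNormalSubgroup G₁ (preimage N′)
    preimage-normal = record
      { ε∈N = back (CongN′.ε≈⇒∈ (K⊆N′ f-ε))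
      ; ∙-closed = λ {a} {b} p q →
          back (CongN′.∈-resp-≈ (SubN′.∙-closed (forth p) (forth q)) (K⊆N′ (CongK.≈-sym (f-∙ a b))))
      ; ⁻¹-closed = λ {a} p → back (CongN′.∈-resp-≈ (SubN′.⁻¹-closed (forth p)) (K⊆N′ (f-⁻¹ a)))
      ; conj-closed = λ g {n} p →
          back (CongN′.∈-resp-≈ (SubN′.conj-closed (f g) (forth p))
                 (K⊆N′ (CongK.≈-sym (CongK.≈-trans (f-∙ (g ∙₁ n) (g ⁻¹₁))
                   (CongK.∙-cong (f-∙ g n) (CongK.≈-sym (f-⁻¹ g)))))))
      }
      where
      forth : ∀ {v} → v ∈ preimage N′ → f v ∈ N′
      forth = to preimage-char
      back : ∀ {v} → f v ∈ N′ → v ∈ preimage N′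
      back = from preimage-char

    module CongPre = Congruence G₁ (preimage N′) preimage-normal
    open CongPre using () renaming (_≈_ to _≈Pre_)

    preimage-cong : ∀ {a b} → a ≈Pre b ⇔ f a ≈N′ f b
    preimage-cong {a} {b} = mk⇔
      (λ p → CongN′.∈-resp-≈ (to preimage-char p) (K⊆N′ (CongK.≈-sym (f-\\ a b))))
      (λ p → from preimage-char (CongN′.∈-resp-≈ p (K⊆N′ (f-\\ a b))))

  InR : Idx → A → B → Set
  InR α a b = ∃[ γ ] (a ∈ Hγ γ × b ∈ prod G₂ (Kγ γ) (Kγ α))

  InR-char : ∀ α {a b} → InR α a b ⇔ f a ∙₂ f (rep α) ≈K b
  InR-char α {a} {b} = mk⇔ InR⇒ ⇒InR
    where
    InR⇒ : InR α a b → f a ∙₂ f (rep α) ≈K b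
    InR⇒ (γ , a∈Hγ , u , v , u∈Kγ , v∈Kα , refl) =
      CongK.≈-trans (CongK.∙-congʳ (f (rep α)) (f-cong (CongH.≈-sym (CongH.coset⇒≈ a∈Hγ))))
                    (CongK.∙-cong (CongK.coset⇒≈ u∈Kγ) (CongK.coset⇒≈ v∈Kα))

    ⇒InR : f a ∙₂ f (rep α) ≈K b → InR α a b
    ⇒InR p with rep-cover a
    ... | γ , a∈Hγ = γ , a∈Hγ , r , r ⁻¹₂ ∙₂ b , CongK.≈⇒coset CongK.≈-refl , CongK.≈⇒coset rα≈r⁻¹b ,
                     sym (G₂.\\-leftDividesˡ r b)
      where
      r : B
      r = f (rep γ)
      rα≈r⁻¹b : f (rep α) ≈K r ⁻¹₂ ∙₂ b
      rα≈r⁻¹b = CongK.∙-cancelˡ r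
        (CongK.≈-resp-≡ refl (sym (G₂.\\-leftDividesˡ r b))
          (CongK.≈-trans (CongK.∙-congʳ (f (rep α)) (f-cong (CongH.coset⇒≈ a∈Hγ))) p))

  rep-0∈H : rep 0ᵢ ∈ H
  rep-0∈H = proj₁ rep-0 (CongH.≈⇒coset CongH.≈-refl)

module Triangle {X Y Z : Set} {Gx : GroupOn X} {Gy : GroupOn Y} {Gz : GroupOn Z}
                (P : QIso Gx Gy) (Q : QIso Gy Gz) (R : QIso Gx Gz) where
  private
    module P = QuotientIso P
    module Q = QuotientIso Q
    module R = QuotientIso R
    module GX = GroupFacts Gx
    module GY = GroupFacts Gy
    module GZ = GroupFacts Gz
  open GX using () renaming (_∙_ to _∙x_; ε to εx; _⁻¹ to _⁻¹x)
  open GY using () renaming (_∙_ to _∙y_)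
  open GZ using () renaming (_∙_ to _∙z_; _⁻¹ to _⁻¹z)
  open Q.CongK using () renaming (_≈_ to _≈K₂_)
  open R.CongK using () renaming (_≈_ to _≈K₃_)

  f : X → Y
  f = P.f
  g : Y → Z
  g = Q.f
  h : X → Z
  h = R.f

  module ProdKH = ProductSubgroup Gy P.K-normal Q.H-normal
  KH : Pred Y 0ℓ
  KH = ProdKH.N₁N₂
  module KH≈ = ProdKH.Cong
  open KH≈ using () renaming (_≈_ to _≈KH_)

  module ImgL = Q.Image KH ProdKH.normal
  L : Pred Z 0ℓ
  L = ImgL.Img
  module L≈ = ImgL.CongImg
  open L≈ using () renaming (_≈_ to _≈L_)

  module PreM = P.Preimage KH ProdKH.normal ProdKH.N₁⊆N₁N₂
  M : Pred X 0ℓ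
  M = P.preimage KH

  M-normal : IsNormalSubgroup Gx M
  M-normal = PreM.preimage-normal

  g-cong : ∀ {b b′} → b ≈KH b′ → g b ≈L g b′
  g-cong = ImgL.Img-cong

  g-reflect : ∀ {b b′} → g b ≈L g b′ → b ≈KH b′
  g-reflect = ImgL.Img-reflect ProdKH.N₂⊆N₁N₂

  g∘f-reflect-∈ : ∀ {a} → g (f a) ∈ L → a ∈ M
  g∘f-reflect-∈ p = from PreM.preimage-char (ImgL.Img-reflect-∈ ProdKH.N₂⊆N₁N₂ p)

  module ImgHM = R.Image M M-normal
  open ImgHM.CongImg using () renaming (_≈_ to _≈hM_)

  CondIV : Set
  CondIV = (R.H ⊆ M) × (∀ a → Q.image (P.image (coset Gx a M)) ≐ R.image (coset Gx a M))

  -- φ_xy maps a M onto the KH-coset of f a, because φ_xy[M] = KH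
  P-image-coset : ∀ a {b} → b ∈ P.image (coset Gx a M) ⇔ f a ≈KH b
  P-image-coset a = mk⇔ (f[M]⊆KH ∘ to (ImgM.image-coset PreM.H⊆preimage a))
                        (from (ImgM.image-coset PreM.H⊆preimage a) ∘ KH⊆f[M])
    where
    module ImgM = P.Image M M-normal
    f[M]⊆KH : ImgM.Img ⊆ KH
    f[M]⊆KH (m , m∈M , p) = KH≈.∈-resp-≈ (to PreM.preimage-char m∈M) (ProdKH.N₁⊆N₁N₂ p)
    KH⊆f[M] : KH ⊆ ImgM.Img
    KH⊆f[M] {b} b∈KH = let (m , p) = P.f-onto b in
      m , from PreM.preimage-char (KH≈.∈-resp-≈ b∈KH (ProdKH.N₁⊆N₁N₂ (P.CongK.≈-sym p))) , p

  composite-image : ∀ a {c} → c ∈ Q.image (P.image (coset Gx a M)) ⇔ g (f a) ≈L c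
  composite-image a = mk⇔
    (to image-fa ∘ Q.image-⊆ (KH≈.≈⇒coset ∘ to (P-image-coset a)))
    (Q.image-⊆ (from (P-image-coset a) ∘ KH≈.coset⇒≈) ∘ from image-fa)
    where
    image-fa : ∀ {c} → c ∈ Q.image (coset Gy (f a) KH) ⇔ g (f a) ≈L c
    image-fa = ImgL.image-coset ProdKH.N₂⊆N₁N₂ (f a)

  record Coherent : Set where
    field
      H₃⊆M  : R.H ⊆ M
      K₃⊆L  : R.K ⊆ L
      g∘f≈h : ∀ a → g (f a) ≈L h a

    h[M]≐L : ImgHM.Img ≐ L
    h[M]≐L = h[M]⊆L , L⊆h[M]
      where
      h[M]⊆L : ImgHM.Img ⊆ L
      h[M]⊆L (m , m∈M , p) =
        L≈.∈-resp-≈ (ImgL.f∈Img (to PreM.preimage-char m∈M))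
          (L≈.≈-trans (g∘f≈h m) (K₃⊆L p))
      L⊆h[M] : L ⊆ ImgHM.Img
      L⊆h[M] {c} c∈L = let (u , p) = R.f-onto c in
        u , g∘f-reflect-∈ (L≈.∈-resp-≈ c∈L (L≈.≈-trans (K₃⊆L (R.CongK.≈-sym p)) (L≈.≈-sym (g∘f≈h u)))) , p

  open Coherent

  R-image-coset : R.H ⊆ M → ∀ a {c} → c ∈ R.image (coset Gx a M) ⇔ h a ≈hM c
  R-image-coset H₃⊆M = ImgHM.image-coset H₃⊆M

  coherent⇒iv : Coherent → CondIV
  coherent⇒iv coh = H₃⊆M coh , λ a →
      (λ c∈T → from (R-image-coset (H₃⊆M coh) a)
                 (proj₂ (h[M]≐L coh) (L≈.≈-trans (L≈.≈-sym (g∘f≈h coh a)) (to (composite-image a) c∈T))))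
    , (λ c∈R → from (composite-image a)
                 (L≈.≈-trans (g∘f≈h coh a) (proj₁ (h[M]≐L coh) (to (R-image-coset (H₃⊆M coh) a) c∈R))))

  iv⇒coherent : CondIV → Coherent
  iv⇒coherent (H₃⊆M′ , T≐R) = record { H₃⊆M = H₃⊆M′ ; K₃⊆L = K₃⊆L′ ; g∘f≈h = g∘f≈h′ }
    where
    h≈⇒g∘f≈ : ∀ {a c} → h a ≈hM c → g (f a) ≈L c
    h≈⇒g∘f≈ {a} p = to (composite-image a) (proj₂ (T≐R a) (from (R-image-coset H₃⊆M′ a) p))

    g∘f≈h′ : ∀ a → g (f a) ≈L h a
    g∘f≈h′ a = h≈⇒g∘f≈ ImgHM.CongImg.≈-refl

    -- h ε ≈ h ε k modulo h[M] for k ∈ K₃, hence also modulo L; so k ∈ L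
    K₃⊆L′ : R.K ⊆ L
    K₃⊆L′ k∈K₃ = L≈.≈∙⇒∈ (h εx)
      (L≈.≈-trans (L≈.≈-sym (g∘f≈h′ εx))
                          (h≈⇒g∘f≈ (ImgHM.K⊆Img (R.CongK.∈⇒≈∙ (h εx) k∈K₃))))

  Comp : P.Idx → Q.Idx → X → Z → Set
  Comp α β a c = ∃[ b ] (P.InR α a b × Q.InR β b c)

  comp-char : ∀ α β {a c} → Comp α β a c ⇔ g (f a ∙y (f (P.rep α) ∙y Q.rep β)) ≈L c
  comp-char α β {a} {c} = mk⇔ comp⇒ ⇒comp
    where
    s p : Y
    s = Q.rep β
    p = f a ∙y f (P.rep α)

    reassoc : g (f a ∙y (f (P.rep α) ∙y s)) ≈L g (p ∙y s)
    reassoc = L≈.≡⇒≈ (cong g (sym (GY.assoc (f a) (f (P.rep α)) s)))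

    comp⇒ : Comp α β a c → g (f a ∙y (f (P.rep α) ∙y s)) ≈L c
    comp⇒ (b , ab∈Rα , bc∈Rβ) = begin
      g (f a ∙y (f (P.rep α) ∙y s))  ≈⟨ reassoc ⟩
      g (p ∙y s)                     ≈⟨ g-cong (ProdKH.N₁⊆N₁N₂ (P.CongK.∙-congʳ s (to (P.InR-char α) ab∈Rα))) ⟩
      g (b ∙y s)                     ≈⟨ ImgL.K⊆Img (Q.f-∙ b s) ⟩
      g b ∙z g s                     ≈⟨ ImgL.K⊆Img (to (Q.InR-char β) bc∈Rβ) ⟩
      c                              ∎
      where open L≈.≈-Reasoning

    -- choose d with g d ≈ c (g s)⁻¹; then p ≈ d modulo KH, and a middle point b
    -- with p ≈ b modulo K₁ and b ≈ d modulo H₂ links a to c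
    ⇒comp : g (f a ∙y (f (P.rep α) ∙y s)) ≈L c → Comp α β a c
    ⇒comp q = let (d , gd≈cs⁻¹) = Q.f-onto (c ∙z g s ⁻¹z)
                  (b , p≈b , b≈d) = ProdKH.factor (p≈d d gd≈cs⁻¹)
              in b , from (P.InR-char α) p≈b , from (Q.InR-char β) (gb∙gs≈c d gd≈cs⁻¹ b≈d)
      where
      p≈d : ∀ d → g d ≈K₂ c ∙z g s ⁻¹z → p ≈KH d
      p≈d d gd≈cs⁻¹ = g-reflect (L≈.∙-cancelʳ (g s) (begin
        g p ∙z g s                     ≈⟨ ImgL.K⊆Img (Q.f-∙ p s) ⟨
        g (p ∙y s)                     ≈⟨ reassoc ⟨
        g (f a ∙y (f (P.rep α) ∙y s))  ≈⟨ q ⟩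
        c                              ≡⟨ GZ.//-rightDividesˡ (g s) c ⟨
        (c ∙z g s ⁻¹z) ∙z g s          ≈⟨ L≈.∙-congʳ (g s) (ImgL.K⊆Img (Q.CongK.≈-sym gd≈cs⁻¹)) ⟩
        g d ∙z g s                     ∎))
        where open L≈.≈-Reasoning

      gb∙gs≈c : ∀ d → g d ≈K₂ c ∙z g s ⁻¹z → ∀ {b} → b Q.CongH.≈ d → g b ∙z g s ≈K₂ c
      gb∙gs≈c d gd≈cs⁻¹ b≈d = Q.CongK.≈-resp-≡ refl (GZ.//-rightDividesˡ (g s) c)
        (Q.CongK.∙-congʳ (g s) (Q.CongK.≈-trans (Q.f-cong b≈d) gd≈cs⁻¹))

  Below : P.Idx → Q.Idx → R.Idx → Set
  Below α β γ = R.Hγ γ ⊆ P.preimage (prod Gy (P.Kγ α) (Q.Hγ β))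

  Rhs : P.Idx → Q.Idx → X → Z → Set
  Rhs α β a c = ∃[ γ ] (Below α β γ × R.InR γ a c)

  target-char : ∀ α β {v} →
    v ∈ P.preimage (prod Gy (P.Kγ α) (Q.Hγ β)) ⇔ f (P.rep α) ∙y Q.rep β ≈KH f v
  target-char α β = mk⇔
    (to (PreM.preimage-coset w) ∘ P.preimage-⊆ (KH≈.≈⇒coset ∘ to product))
    (P.preimage-⊆ (from product ∘ KH≈.coset⇒≈) ∘ from (PreM.preimage-coset w))
    where
    w : Y
    w = f (P.rep α) ∙y Q.rep β
    product : ∀ {d} → prod Gy (P.Kγ α) (Q.Hγ β) d ⇔ w ≈KH d
    product = ProdKH.coset-product (f (P.rep α)) (Q.rep β)

  Below-char : R.H ⊆ M → ∀ α β γ → Below α β γ ⇔ f (P.rep α) ∙y Q.rep β ≈KH f (R.rep γ)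
  Below-char H₃⊆M α β γ = mk⇔
    (λ below → to (target-char α β) (below (R.CongH.≈⇒coset R.CongH.≈-refl)))
    (λ p {_} v∈Hγ → from (target-char α β)
                  (KH≈.≈-trans p (to PreM.preimage-cong (H₃⊆M (R.CongH.coset⇒≈ v∈Hγ)))))

  coherent⇒iii : Coherent → ∀ α β {a c} → Comp α β a c ⇔ Rhs α β a c
  coherent⇒iii coh α β {a} {c} = mk⇔ (comp⇒rhs ∘ to (comp-char α β)) (from (comp-char α β) ∘ rhs⇒comp)
    where
    open L≈.≈-Reasoning
    w : Y
    w = f (P.rep α) ∙y Q.rep β

    rhs⇒comp : Rhs α β a c → g (f a ∙y w) ≈L c
    rhs⇒comp (γ , below , ac∈Rγ) = begin
      g (f a ∙y w)          ≈⟨ g-cong (KH≈.∙-congˡ (f a) (to (Below-char (H₃⊆M coh) α β γ) below)) ⟩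
      g (f a ∙y f t)        ≈⟨ g-cong (ProdKH.N₁⊆N₁N₂ (P.f-∙ a t)) ⟨
      g (f (a ∙x t))        ≈⟨ g∘f≈h coh (a ∙x t) ⟩
      h (a ∙x t)            ≈⟨ K₃⊆L coh (R.f-∙ a t) ⟩
      h a ∙z h t            ≈⟨ K₃⊆L coh (to (R.InR-char γ) ac∈Rγ) ⟩
      c                     ∎
      where
      t : X
      t = R.rep γ

    -- pick u with h u ≈ c and the coset H_{xz,γ} containing a⁻¹ u
    comp⇒rhs : g (f a ∙y w) ≈L c → Rhs α β a c
    comp⇒rhs q with R.f-onto c
    ... | u , hu≈c with R.rep-cover (a ⁻¹x ∙x u)
    ... | γ , a⁻¹u∈Hγ = γ , from (Below-char (H₃⊆M coh) α β γ) w≈ft , from (R.InR-char γ) ha∙ht≈c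
      where
      t : X
      t = R.rep γ

      ha∙ht≈c : h a ∙z h t ≈K₃ c
      ha∙ht≈c = R.CongK.≈-trans (R.CongK.∙-congˡ (h a) (R.f-cong (R.CongH.coset⇒≈ a⁻¹u∈Hγ)))
                (R.CongK.≈-trans (R.CongK.≈-sym (R.f-∙ a (a ⁻¹x ∙x u)))
                (R.CongK.≈-resp-≡ (cong h (sym (GX.\\-leftDividesˡ a u))) refl hu≈c))

      w≈ft : w ≈KH f t
      w≈ft = g-reflect (L≈.∙-cancelˡ (g (f a)) (begin
        g (f a) ∙z g w        ≈⟨ ImgL.K⊆Img (Q.f-∙ (f a) w) ⟨
        g (f a ∙y w)          ≈⟨ q ⟩
        c                     ≈⟨ K₃⊆L coh ha∙ht≈c ⟨
        h a ∙z h t            ≈⟨ L≈.∙-cong (g∘f≈h coh a) (g∘f≈h coh t) ⟨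
        g (f a) ∙z g (f t)    ∎))

  IsUnionOver : Pred R.Idx 0ℓ → Set
  IsUnionOver Γ = ∀ a c → Comp P.0ᵢ Q.0ᵢ a c ⇔ (∃[ γ ] (γ ∈ Γ × R.InR γ a c))

  comp₀₀-char : ∀ {a c} → Comp P.0ᵢ Q.0ᵢ a c ⇔ g (f a) ≈L c
  comp₀₀-char {a} {c} = mk⇔
    (λ ac → L≈.≈-trans fa≈ (to (comp-char P.0ᵢ Q.0ᵢ) ac))
    (λ p → from (comp-char P.0ᵢ Q.0ᵢ) (L≈.≈-trans (L≈.≈-sym fa≈) p))
    where
    -- f(rep 0) ∈ K₁ and rep 0 ∈ H₂, so their product lies in KH
    fa≈ : g (f a) ≈L g (f a ∙y (f (P.rep P.0ᵢ) ∙y Q.rep Q.0ᵢ))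
    fa≈ = g-cong (KH≈.∈⇒≈∙ (f a)
            (_ , _ , P.f[H]⊆K P.rep-0∈H , Q.rep-0∈H , refl))

  -- Fix γ₀ ∈ Γ with (ε, g(f ε)) ∈ R_{xz,γ₀}.  Every pair in R_{xz,γ₀}
  -- is related by g ∘ f modulo L; comparing the pairs (ε, h ε t₀) and
  -- (ε, h ε t₀ k), t₀ = h(rep γ₀), gives K₃ ⊆ L, then t₀ ∈ L and g ∘ f ≈ h.
  union⇒coherent : ∀ {Γ} → IsUnionOver Γ → Coherent
  union⇒coherent {Γ} union = record { H₃⊆M = H₃⊆M′ ; K₃⊆L = K₃⊆L′ ; g∘f≈h = g∘f≈h′ }
    where
    sound : ∀ {γ a c} → γ ∈ Γ → h a ∙z h (R.rep γ) ≈K₃ c → g (f a) ≈L c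
    sound {γ} {a} {c} γ∈Γ p = to comp₀₀-char (from (union a c) (γ , γ∈Γ , from (R.InR-char γ) p))

    complete : ∀ {a c} → g (f a) ≈L c → ∃[ γ ] (γ ∈ Γ × h a ∙z h (R.rep γ) ≈K₃ c)
    complete {a} {c} p = let (γ , γ∈Γ , ac∈Rγ) = to (union a c) (from comp₀₀-char p) in
                         γ , γ∈Γ , to (R.InR-char γ) ac∈Rγ

    γ₀ : R.Idx
    γ₀ = proj₁ (complete {εx} L≈.≈-refl)
    γ₀∈Γ : γ₀ ∈ Γ
    γ₀∈Γ = proj₁ (proj₂ (complete {εx} L≈.≈-refl))
    t₀ : Z
    t₀ = h (R.rep γ₀)

    K₃⊆L′ : R.K ⊆ L
    K₃⊆L′ k∈K₃ = L≈.≈∙⇒∈ (h εx ∙z t₀)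
      (L≈.≈-trans (L≈.≈-sym (sound γ₀∈Γ R.CongK.≈-refl)) (sound γ₀∈Γ (R.CongK.∈⇒≈∙ _ k∈K₃)))

    -- g (f ε) and h ε both lie in L, and g (f ε) ≈ h ε t₀
    t₀∈L : t₀ ∈ L
    t₀∈L = L≈.≈∙⇒∈ (h εx)
      (L≈.≈-trans (L≈.∈⇒≈ (K₃⊆L′ (R.f[H]⊆K R.SubH.ε∈N)) gfε∈L) (sound γ₀∈Γ R.CongK.≈-refl))
      where
      gfε∈L : g (f εx) ∈ L
      gfε∈L = ImgL.f∈Img (ProdKH.N₁⊆N₁N₂ (P.f[H]⊆K P.SubH.ε∈N))

    g∘f≈h′ : ∀ a → g (f a) ≈L h a
    g∘f≈h′ a = L≈.≈-trans (sound γ₀∈Γ R.CongK.≈-refl) (L≈.≈-sym (L≈.∈⇒≈∙ (h a) t₀∈L))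

    H₃⊆M′ : R.H ⊆ M
    H₃⊆M′ {v} v∈H₃ = g∘f-reflect-∈
      (L≈.∈-resp-≈ (K₃⊆L′ (R.f[H]⊆K v∈H₃)) (L≈.≈-sym (g∘f≈h′ v)))

module Relations (𝓕 : GroupPair) where
  open GroupPair 𝓕
  open GroupPairTheory 𝓕

  ≐ᴿ-sym : ∀ {R S} → R ≐ᴿ S → S ≐ᴿ R
  ≐ᴿ-sym (R⊆S , S⊆R) = S⊆R , R⊆S

  ≐ᴿ-trans : ∀ {R S T} → R ≐ᴿ S → S ≐ᴿ T → R ≐ᴿ T
  ≐ᴿ-trans (R⊆S , S⊆R) (S⊆T , T⊆S) = (λ i j a b → S⊆T i j a b ∘ R⊆S i j a b) ,
                                     (λ i j a b → S⊆R i j a b ∘ T⊆S i j a b)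

  ⨾-cong : ∀ {R R′ S S′} → R ≐ᴿ R′ → S ≐ᴿ S′ → (R ⨾ S) ≐ᴿ (R′ ⨾ S′)
  ⨾-cong (R⊆R′ , R′⊆R) (S⊆S′ , S′⊆S) =
    (λ i k a c (j , b , r , s) → j , b , R⊆R′ i j a b r , S⊆S′ j k b c s) ,
    (λ i k a c (j , b , r , s) → j , b , R′⊆R i j a b r , S′⊆S j k b c s)

  On-cong : ∀ {x z} {P P′ : C x → C z → Set} → (∀ {a c} → P a c ⇔ P′ a c) → On P ≐ᴿ On P′
  On-cong P⇔P′ = (λ { _ _ _ _ (on p) → on (to P⇔P′ p) }) , (λ { _ _ _ _ (on p) → on (from P⇔P′ p) })

  InA-resp : ∀ {R S} → R ≐ᴿ S → InA S → InA R
  InA-resp R≐S (U , S≐⋃U) = U , ≐ᴿ-trans R≐S S≐⋃U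

  UnionAlong : ∀ {u v} (e : E u v) → Pred (QIso.Idx (φ e)) 0ℓ → BRel
  UnionAlong e Γ i k a c = ∃[ γ ] (γ ∈ Γ × Rel e γ i k a c)

  UnionAlong∈A : ∀ {u v} (e : E u v) Γ → InA (UnionAlong e Γ)
  UnionAlong∈A {u} {v} e Γ = U , (λ { _ _ _ _ (γ , γ∈Γ , r) → (u , v , e , γ) , (γ , refl , γ∈Γ) , r }) ,
                                 (λ { _ _ _ _ (_ , (γ , refl , γ∈Γ) , r) → γ , γ∈Γ , r })
    where
    U : Pred Index 0ℓ
    U ι = ∃[ γ ] (ι ≡ (u , v , e , γ) × γ ∈ Γ)

  Rel∈A : ∀ {u v} (e : E u v) α → InA (Rel e α)
  Rel∈A {u} {v} e α = (λ ι → ι ≡ (u , v , e , α)) , (λ _ _ _ _ r → _ , refl , r) ,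
                                                     (λ { _ _ _ _ (_ , refl , r) → r })

  unOn : ∀ {x z} {P : C x → C z → Set} {a c} → On P x z a c → P a c
  unOn (on p) = p

  module _ {x y z : I} (e₁ : E x y) (e₂ : E y z) where
    private
      module T = Triangle (φ e₁) (φ e₂) (φ (e₃ e₁ e₂))

    M-normal : IsNormalSubgroup (G x) (M e₁ e₂)
    M-normal = T.M-normal

    Below : QIso.Idx (φ e₁) → QIso.Idx (φ e₂) → Pred (QIso.Idx (φ (e₃ e₁ e₂))) 0ℓ
    Below = T.Below

    ⨾-local : ∀ α β → (Rel e₁ α ⨾ Rel e₂ β) ≐ᴿ On (T.Comp α β)
    ⨾-local α β = (λ { _ _ _ _ (_ , b , on p , on q) → on (b , p , q) }) ,
                  (λ { _ _ _ _ (on (b , p , q)) → y , b , on p , on q })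

    rhs-local : ∀ α β → UnionAlong (e₃ e₁ e₂) (Below α β) ≐ᴿ On (T.Rhs α β)
    rhs-local α β = (λ { _ _ _ _ (γ , below , on r) → on (γ , below , r) }) ,
                    (λ { _ _ _ _ (on (γ , below , r)) → γ , below , on r })

    iv⇒iii : cond-iv e₁ e₂ → cond-iii e₁ e₂
    iv⇒iii iv α β = ≐ᴿ-trans (⨾-local α β)
                   (≐ᴿ-trans (On-cong (T.coherent⇒iii (T.iv⇒coherent iv) α β)) (≐ᴿ-sym (rhs-local α β)))

    iii⇒ii : cond-iii e₁ e₂ → cond-ii e₁ e₂
    iii⇒ii iii α β = InA-resp (iii α β) (UnionAlong∈A (e₃ e₁ e₂) (Below α β))

    ii⇒i : cond-ii e₁ e₂ → cond-i e₁ e₂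
    ii⇒i ii = ii _ _

    i⇒iv : cond-i e₁ e₂ → cond-iv e₁ e₂
    i⇒iv (U , ⨾⊆⋃U , ⋃U⊆⨾) = T.coherent⇒iv (T.union⇒coherent union)
      where
      Γ : Pred (QIso.Idx (φ (e₃ e₁ e₂))) 0ℓ
      Γ γ = (x , z , e₃ e₁ e₂ , γ) ∈ U

      -- a member of U relating G_x to G_z is some R_{xz,γ}; as ℰ is a relation,
      -- its witness of (x, z) ∈ ℰ is e₃, so γ ∈ Γ
      restrict : ∀ {a c} → ⋃ᴿ U x z a c → ∃[ γ ] (γ ∈ Γ × QuotientIso.InR (φ (e₃ e₁ e₂)) γ a c)
      restrict ((_ , _ , e , γ) , ι∈U , on r) with E-prop e (e₃ e₁ e₂)
      ... | refl = γ , ι∈U , r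

      union : T.IsUnionOver Γ
      union a c = mk⇔
        (λ p → restrict (⨾⊆⋃U x z a c (proj₂ (⨾-local _ _) x z a c (on p))))
        (λ { (γ , γ∈Γ , r) → unOn (proj₁ (⨾-local _ _) x z a c
                                 (⋃U⊆⨾ x z a c ((x , z , e₃ e₁ e₂ , γ) , γ∈Γ , on r))) })

  -- The indices making up ⋃U₁ ; ⋃U₂ when (iii) holds everywhere: the R_{xz,γ}
  -- below some R_{xy,α} ∈ U₁ and R_{yz,β} ∈ U₂.
  Composed : Pred Index 0ℓ → Pred Index 0ℓ → Pred Index 0ℓ
  Composed U₁ U₂ ι =
    Σ I λ x → Σ I λ y → Σ I λ z → Σ (E x y) λ e₁ → Σ (E y z) λ e₂ →
    Σ (QIso.Idx (φ e₁)) λ α → Σ (QIso.Idx (φ e₂)) λ β → Σ (QIso.Idx (φ (e₃ e₁ e₂))) λ γ →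
    (x , y , e₁ , α) ∈ U₁ × (y , z , e₂ , β) ∈ U₂ × ι ≡ (x , z , e₃ e₁ e₂ , γ) × γ ∈ Below e₁ e₂ α β

  -- composition distributes over the unions, and (iii) resolves each composite
  ⋃⨾⋃ : (∀ {x y z} (e₁ : E x y) (e₂ : E y z) → cond-iii e₁ e₂) →
        ∀ U₁ U₂ → (⋃ᴿ U₁ ⨾ ⋃ᴿ U₂) ≐ᴿ ⋃ᴿ (Composed U₁ U₂)
  ⋃⨾⋃ iii U₁ U₂ = (λ i k a c (j , b , r₁ , r₂) → compose r₁ r₂) , decompose
    where
    compose : ∀ {i j k a b c} → ⋃ᴿ U₁ i j a b → ⋃ᴿ U₂ j k b c → ⋃ᴿ (Composed U₁ U₂) i k a c
    compose {b = b} ((x , y , e₁ , α) , m₁ , on p) ((_ , z , e₂ , β) , m₂ , on q)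
      with proj₁ (iii e₁ e₂ α β) x z _ _ (y , b , on p , on q)
    ... | γ , below , r =
      (x , z , e₃ e₁ e₂ , γ) , (x , y , z , e₁ , e₂ , α , β , γ , m₁ , m₂ , refl , below) , r

    decompose : ⋃ᴿ (Composed U₁ U₂) ⊆ᴿ (⋃ᴿ U₁ ⨾ ⋃ᴿ U₂)
    decompose i k a c (_ , (x , y , z , e₁ , e₂ , α , β , γ , m₁ , m₂ , refl , below) , r)
      with proj₂ (iii e₁ e₂ α β) i k a c (γ , below , r)
    ... | j , b , r₁ , r₂ = j , b , (_ , m₁ , r₁) , (_ , m₂ , r₂)

  closed⇒iv : ClosedUnderComposition → ∀ {x y z} (e₁ : E x y) (e₂ : E y z) → cond-iv e₁ e₂
  closed⇒iv closed e₁ e₂ = i⇒iv e₁ e₂ (closed _ _ (Rel∈A e₁ _) (Rel∈A e₂ _))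

  iv⇒closed : (∀ {x y z} (e₁ : E x y) (e₂ : E y z) → cond-iv e₁ e₂) → ClosedUnderComposition
  iv⇒closed iv R S (U₁ , R≐⋃U₁) (U₂ , S≐⋃U₂) =
    InA-resp (⨾-cong R≐⋃U₁ S≐⋃U₂) (Composed U₁ U₂ , ⋃⨾⋃ (λ e₁ e₂ → iv⇒iii e₁ e₂ (iv e₁ e₂)) U₁ U₂)

theorem3p10 : (𝓕 : GroupPair) → let open GroupPair 𝓕 in let open GroupPairTheory 𝓕 in
    (∀ {x y z} (e₁ : E x y) (e₂ : E y z) →
        IsNormalSubgroup (G x) (M e₁ e₂)
      × (cond-i e₁ e₂ ⇔ cond-ii e₁ e₂)
      × (cond-i e₁ e₂ ⇔ cond-iii e₁ e₂)
      × (cond-i e₁ e₂ ⇔ cond-iv e₁ e₂))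
    × (ClosedUnderComposition ⇔ (∀ {x y z} (e₁ : E x y) (e₂ : E y z) → cond-iv e₁ e₂))
theorem3p10 𝓕 = equivalences , mk⇔ closed⇒iv iv⇒closed
  where
  open GroupPair 𝓕
  open GroupPairTheory 𝓕
  open Relations 𝓕

  equivalences : ∀ {x y z} (e₁ : E x y) (e₂ : E y z) →
        IsNormalSubgroup (G x) (M e₁ e₂)
      × (cond-i e₁ e₂ ⇔ cond-ii e₁ e₂)
      × (cond-i e₁ e₂ ⇔ cond-iii e₁ e₂)
      × (cond-i e₁ e₂ ⇔ cond-iv e₁ e₂)
  equivalences e₁ e₂ =
      M-normal e₁ e₂
    , mk⇔ (iii⇒ii e₁ e₂ ∘ iv⇒iii e₁ e₂ ∘ i⇒iv e₁ e₂) (ii⇒i e₁ e₂)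
    , mk⇔ (iv⇒iii e₁ e₂ ∘ i⇒iv e₁ e₂) (ii⇒i e₁ e₂ ∘ iii⇒ii e₁ e₂)
    , mk⇔ (i⇒iv e₁ e₂) (ii⇒i e₁ e₂ ∘ iii⇒ii e₁ e₂ ∘ iv⇒iii e₁ e₂)
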